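{- Let $\Phi$ be the root system of type $B_n$ and let $w\in W(\Phi)$ avoid the type $A_3$ patterns $3142$ and $2413$ and the two type $B_2$ patterns of length two. Then for every $\beta\in\Phi^+$, the roots $\beta$ and $\widehat\beta$ have the same color with respect to $w$.
   Context: Type $B_n$: $\Phi=\{\pm e_i\pm e_j,\pm e_i\}\subset\mathbb R^n$, positive roots $e_i\pm e_j$ ($i<j$) and $e_i$, simple roots $\alpha_i=e_i-e_{i+1}$ ($1\le i\le n-1$), $\alpha_n=e_n$. For $\beta=\sum_i c_i\alpha_i\in\Phi^+$, $\widehat\beta=\sum_{i:c_i\ne0}\alpha_i$. $I_\Phi(w)=\{\alpha\in\Phi^+:w\alpha\in-\Phi^+\}$; a positive root is black if in $I_\Phi(w)$, white otherwise. A subsystem is $\Phi\cap U$ for a subspace $U$, with positive roots $\Phi^+\cap U$. $w$ contains the pattern $3142$ (resp. $2413$) if for some $U$, $\Phi\cap U$ is of type $A_3$ with simple roots $a_1,a_2,a_3$ ($a_1\perp a_3$) and $I_\Phi(w)\cap U=\{a_1,a_3,a_1+a_2+a_3\}$ (resp. $\{a_2,a_1+a_2,a_2+a_3\}$). $w$ contains a type $B_2$ pattern of length two if for some $U$, $\Phi\cap U$ is of type $B_2$ with simple roots $b_1$ (long), $b_2$ (short), positive roots $b_1,b_2,b_1+b_2,b_1+2b_2$, and $I_\Phi(w)\cap U$ equals $\{b_1,b_1+b_2\}$ or $\{b_2,b_1+2b_2\}$. Avoiding means not containing. -}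

module Defs where

open import Data.Nat using (ℕ; suc)
open import Data.Bool using (Bool; true; false; if_then_else_)
open import Data.Fin using (Fin; toℕ; _<_)
open import Data.Fin.Permutation using (Permutation′; _⟨$⟩ˡ_)
open import Data.Integer using (ℤ; _+_; _*_; -_; 0ℤ; 1ℤ; -1ℤ)
open import Data.Vec using (Vec; tabulate; lookup; zipWith; replicate; foldr; map)
open import Data.Product using (Σ; ∃; ∃₂; _×_; _,_)
open import Data.Sum using (_⊎_)
open import Relation.Binary.PropositionalEquality using (_≡_; _≢_)
open import Relation.Nullary using (¬_; does)
open import Data.Fin using (_≟_)
import Data.Nat as N
open import Function.Bundles using (_⇔_)

-- Vectors in ℤⁿ ⊂ ℝⁿ (all roots of B_n have integer coordinates).
V : ℕ → Set
V n = Vec ℤ n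

infixl 6 _⊕_
_⊕_ : ∀ {n} → V n → V n → V n
_⊕_ = zipWith _+_

_⊙_ : ∀ {n} → ℤ → V n → V n
c ⊙ v = map (c *_) v

neg : ∀ {n} → V n → V n
neg = map -_

⟪_,_⟫ : ∀ {n} → V n → V n → ℤ
⟪ u , v ⟫ = foldr _ _+_ 0ℤ (zipWith _*_ u v)

e : ∀ {n} → Fin n → V n
e i = tabulate λ k → if does (k ≟ i) then 1ℤ else 0ℤ

IsPosRoot : ∀ {n} → V n → Set
IsPosRoot {n} v =
    (Σ (Fin n) λ i → Σ (Fin n) λ j → i < j × v ≡ e i ⊕ neg (e j))
  ⊎ (Σ (Fin n) λ i → Σ (Fin n) λ j → i < j × v ≡ e i ⊕ e j)
  ⊎ (Σ (Fin n) λ i → v ≡ e i)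

-- Simple roots: α_i = e_i - e_{i+1} (i < n), α_n = e_n
-- (for the last index there is no coordinate i+1, giving e_n).
α : ∀ {n} → Fin n → V n
α i = tabulate λ k →
  if does (k ≟ i) then 1ℤ
  else if does (toℕ k N.≟ suc (toℕ i)) then -1ℤ else 0ℤ

lin : ∀ {n} → Vec ℤ n → V n
lin {n} c = foldr _ _⊕_ (replicate n 0ℤ) (tabulate λ i → lookup c i ⊙ α i)

supp : ∀ {n} → Vec ℤ n → Vec ℤ n
supp = map λ x → if does (x Data.Integer.≟ 0ℤ) then 0ℤ else 1ℤ

-- β̂ = Σ_{i : c_i ≠ 0} α_i, where β = Σ_i c_i α_i
hat : ∀ {n} → Vec ℤ n → V n
hat c = lin (supp c)

-- Weyl group W(B_n): signed permutations, w(e_i) = ± e_{σ(i)}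
-- (sign negative iff ε i = true).
record W (n : ℕ) : Set where
  constructor sperm
  field
    σ : Permutation′ n
    ε : Fin n → Bool

act : ∀ {n} → W n → V n → V n
act (sperm σ ε) v = tabulate λ k →
  (if ε (σ ⟨$⟩ˡ k) then -1ℤ else 1ℤ) * lookup v (σ ⟨$⟩ˡ k)

-- β ∈ I_Φ(w)  (black):  w β ∈ -Φ⁺
Black : ∀ {n} → W n → V n → Set
Black w v = IsPosRoot (neg (act w v))

-- membership in the real span of integer vectors, written with integers:
-- v ∈ span_ℝ(a₁,…) iff c·v = Σ cᵢ aᵢ for some integers c ≠ 0, cᵢ.
InSpan3 : ∀ {n} → V n → V n → V n → V n → Set
InSpan3 v a1 a2 a3 = Σ ℤ λ c → Σ ℤ λ c1 → Σ ℤ λ c2 → Σ ℤ λ c3 →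
  c ≢ 0ℤ × c ⊙ v ≡ c1 ⊙ a1 ⊕ c2 ⊙ a2 ⊕ c3 ⊙ a3

InSpan2 : ∀ {n} → V n → V n → V n → Set
InSpan2 v b1 b2 = Σ ℤ λ c → Σ ℤ λ c1 → Σ ℤ λ c2 →
  c ≢ 0ℤ × c ⊙ v ≡ c1 ⊙ b1 ⊕ c2 ⊙ b2

-- Φ ∩ U (U = span(a₁,a₂,a₃)) is of type A₃ with simple roots a₁,a₂,a₃,
-- a₁ ⊥ a₃, i.e. its positive roots Φ⁺ ∩ U are exactly the six roots
-- a₁, a₂, a₃, a₁+a₂, a₂+a₃, a₁+a₂+a₃, with the A₃ Cartan data.
IsA3 : ∀ {n} → V n → V n → V n → Set
IsA3 a1 a2 a3 =
  IsPosRoot a1 × IsPosRoot a2 × IsPosRoot a3 ×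
  ⟪ a1 , a1 ⟫ ≡ ⟪ a2 , a2 ⟫ × ⟪ a3 , a3 ⟫ ≡ ⟪ a2 , a2 ⟫ ×
  2ℤ' * ⟪ a1 , a2 ⟫ ≡ - ⟪ a2 , a2 ⟫ × 2ℤ' * ⟪ a2 , a3 ⟫ ≡ - ⟪ a2 , a2 ⟫ ×
  ⟪ a1 , a3 ⟫ ≡ 0ℤ ×
  (∀ γ → IsPosRoot γ →
    (InSpan3 γ a1 a2 a3 ⇔
      (γ ≡ a1 ⊎ γ ≡ a2 ⊎ γ ≡ a3 ⊎ γ ≡ a1 ⊕ a2 ⊎ γ ≡ a2 ⊕ a3 ⊎ γ ≡ a1 ⊕ a2 ⊕ a3)))
  where 2ℤ' = Data.Integer.+ 2

Contains3142 : ∀ {n} → W n → Set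
Contains3142 {n} w = Σ (V n) λ a1 → Σ (V n) λ a2 → Σ (V n) λ a3 →
  IsA3 a1 a2 a3 ×
  (∀ γ → IsPosRoot γ → InSpan3 γ a1 a2 a3 →
    (Black w γ ⇔ (γ ≡ a1 ⊎ γ ≡ a3 ⊎ γ ≡ a1 ⊕ a2 ⊕ a3)))

Contains2413 : ∀ {n} → W n → Set
Contains2413 {n} w = Σ (V n) λ a1 → Σ (V n) λ a2 → Σ (V n) λ a3 →
  IsA3 a1 a2 a3 ×
  (∀ γ → IsPosRoot γ → InSpan3 γ a1 a2 a3 →
    (Black w γ ⇔ (γ ≡ a2 ⊎ γ ≡ a1 ⊕ a2 ⊎ γ ≡ a2 ⊕ a3)))

-- Φ ∩ U (U = span(b₁,b₂)) is of type B₂ with simple roots b₁ (long),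
-- b₂ (short), positive roots b₁, b₂, b₁+b₂, b₁+2b₂.
IsB2 : ∀ {n} → V n → V n → Set
IsB2 b1 b2 =
  IsPosRoot b1 × IsPosRoot b2 ×
  ⟪ b1 , b1 ⟫ ≡ 2ℤ' * ⟪ b2 , b2 ⟫ × ⟪ b1 , b2 ⟫ ≡ - ⟪ b2 , b2 ⟫ ×
  (∀ γ → IsPosRoot γ →
    (InSpan2 γ b1 b2 ⇔
      (γ ≡ b1 ⊎ γ ≡ b2 ⊎ γ ≡ b1 ⊕ b2 ⊎ γ ≡ b1 ⊕ b2 ⊕ b2)))
  where 2ℤ' = Data.Integer.+ 2

ContainsB2len2 : ∀ {n} → W n → Set
ContainsB2len2 {n} w = Σ (V n) λ b1 → Σ (V n) λ b2 →
  IsB2 b1 b2 ×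
  ((∀ γ → IsPosRoot γ → InSpan2 γ b1 b2 →
     (Black w γ ⇔ (γ ≡ b1 ⊎ γ ≡ b1 ⊕ b2)))
  ⊎ (∀ γ → IsPosRoot γ → InSpan2 γ b1 b2 →
     (Black w γ ⇔ (γ ≡ b2 ⊎ γ ≡ b1 ⊕ b2 ⊕ b2))))

module Submission where

-- Writing
-- β = Σ c_k α_k, the coefficient c_k is the partial sum β_0 + ⋯ + β_k, so
-- for e_i − e_j and e_i all coefficients are 0 or 1 and β̂ = β, while for
-- e_i + e_j they are 0, 1 and 2 and β̂ = e_i.  It remains to show that
-- e_i + e_j and e_i have the same colour.  A signed permutation w = (σ, ε)
-- sends e_i to ∓e_{σ i}, and a positive root is recognised by its first
-- nonzero coordinate being +1; hence e_i is black iff ε i, and e_i ± e_j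
-- takes its colour from the summand whose σ-image comes first.  When that
-- is e_j and e_i, e_j have different colours, the B₂ subsystem spanned by
-- e_i − e_j and e_j carries one of the two forbidden colourings.

open import Defs
open import Data.Nat using (ℕ; zero; suc; s≤s)
open import Data.Bool using (Bool; true; false; if_then_else_; not)
open import Data.Fin using (Fin; zero; suc; _<_; _≟_)
import Data.Fin.Properties as Finₚ
open import Data.Fin.Permutation using (Permutation′; _⟨$⟩ˡ_; _⟨$⟩ʳ_; inverseˡ; inverseʳ)
open import Data.Vec using (Vec; []; _∷_; tabulate; lookup; replicate; foldr; tail)
import Data.Vec.Properties as Vecₚ
open import Data.Integer using (ℤ; _+_; _*_; -_; _-_; 0ℤ; 1ℤ; -1ℤ)
import Data.Integer.Properties as ℤₚ
open import Data.Integer.Tactic.RingSolver using (solve-∀)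
open import Data.Product using (Σ; _×_; _,_)
open import Data.Sum using (_⊎_; inj₁; inj₂; [_,_])
open import Data.Empty using (⊥-elim)
open import Function using (_∘_; id)
open import Relation.Nullary using (¬_; does; yes; no)
open import Relation.Binary.Definitions using (tri<; tri≈; tri>)
open import Relation.Binary.PropositionalEquality hiding ([_])
open import Function.Bundles using (_⇔_; mk⇔; Equivalence)
import Function.Properties.Equivalence as ⇔

private
  variable
    n : ℕ

≗⇒≡ : {u v : V n} → (∀ k → lookup u k ≡ lookup v k) → u ≡ v
≗⇒≡ {u = u} {v} h =
  trans (sym (Vecₚ.tabulate∘lookup u)) (trans (Vecₚ.tabulate-cong h) (Vecₚ.tabulate∘lookup v))

lookup-⊕ : (u v : V n) (k : Fin n) → lookup (u ⊕ v) k ≡ lookup u k + lookup v k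
lookup-⊕ u v k = Vecₚ.lookup-zipWith _+_ k u v

lookup-neg : (u : V n) (k : Fin n) → lookup (neg u) k ≡ - lookup u k
lookup-neg u k = Vecₚ.lookup-map k -_ u

lookup-⊙ : (c : ℤ) (u : V n) (k : Fin n) → lookup (c ⊙ u) k ≡ c * lookup u k
lookup-⊙ c u k = Vecₚ.lookup-map k (c *_) u

lookup-e-same : (i : Fin n) → lookup (e i) i ≡ 1ℤ
lookup-e-same i rewrite Vecₚ.lookup∘tabulate (λ k → if does (k ≟ i) then 1ℤ else 0ℤ) i
  with i ≟ i
... | yes _   = refl
... | no i≢i = ⊥-elim (i≢i refl)

lookup-e-other : (i k : Fin n) → k ≢ i → lookup (e i) k ≡ 0ℤ
lookup-e-other i k k≢i rewrite Vecₚ.lookup∘tabulate (λ k → if does (k ≟ i) then 1ℤ else 0ℤ) k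
  with k ≟ i
... | yes k≡i = ⊥-elim (k≢i k≡i)
... | no _    = refl

signed : Bool → V n → V n
signed b v = if b then v else neg v

sgn : Bool → ℤ → ℤ
sgn b x = if b then x else - x

lookup-signed : (b : Bool) (v : V n) (k : Fin n) → lookup (signed b v) k ≡ sgn b (lookup v k)
lookup-signed true  v k = refl
lookup-signed false v k = lookup-neg v k

sgn-0 : (b : Bool) → sgn b 0ℤ ≡ 0ℤ
sgn-0 true  = refl
sgn-0 false = refl

sgn-1≢0 : (b : Bool) → sgn b 1ℤ ≢ 0ℤ
sgn-1≢0 true  ()
sgn-1≢0 false ()

sgn-1≡1 : (b : Bool) → sgn b 1ℤ ≡ 1ℤ → b ≡ true
sgn-1≡1 true  _ = refl
sgn-1≡1 false ()

lookup-signed-e-same : (b : Bool) (p : Fin n) → lookup (signed b (e p)) p ≡ sgn b 1ℤ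
lookup-signed-e-same b p = trans (lookup-signed b (e p) p) (cong (sgn b) (lookup-e-same p))

lookup-signed-e-other : (b : Bool) (p k : Fin n) → k ≢ p → lookup (signed b (e p)) k ≡ 0ℤ
lookup-signed-e-other b p k k≢p =
  trans (lookup-signed b (e p) k) (trans (cong (sgn b) (lookup-e-other p k k≢p)) (sgn-0 b))

-- ±e_p ± e_q, the shape of every long root of B_n.  The positive long roots
-- e_p − e_q and e_p + e_q are longRoot true p false q and longRoot true p true q.
longRoot : Bool → Fin n → Bool → Fin n → V n
longRoot s p t q = signed s (e p) ⊕ signed t (e q)

lookup-longRoot-first : (s t : Bool) {p q : Fin n} → p ≢ q → lookup (longRoot s p t q) p ≡ sgn s 1ℤ
lookup-longRoot-first s t {p} {q} p≢q = begin
  lookup (longRoot s p t q) p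
    ≡⟨ lookup-⊕ (signed s (e p)) (signed t (e q)) p ⟩
  lookup (signed s (e p)) p + lookup (signed t (e q)) p
    ≡⟨ cong₂ _+_ (lookup-signed-e-same s p) (lookup-signed-e-other t q p p≢q) ⟩
  sgn s 1ℤ + 0ℤ
    ≡⟨ ℤₚ.+-identityʳ (sgn s 1ℤ) ⟩
  sgn s 1ℤ ∎
  where open ≡-Reasoning

lookup-longRoot-second : (s t : Bool) {p q : Fin n} → p ≢ q → lookup (longRoot s p t q) q ≡ sgn t 1ℤ
lookup-longRoot-second s t {p} {q} p≢q = begin
  lookup (longRoot s p t q) q
    ≡⟨ lookup-⊕ (signed s (e p)) (signed t (e q)) q ⟩
  lookup (signed s (e p)) q + lookup (signed t (e q)) q
    ≡⟨ cong₂ _+_ (lookup-signed-e-other s p q (p≢q ∘ sym)) (lookup-signed-e-same t q) ⟩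
  0ℤ + sgn t 1ℤ
    ≡⟨ ℤₚ.+-identityˡ (sgn t 1ℤ) ⟩
  sgn t 1ℤ ∎
  where open ≡-Reasoning

lookup-longRoot-outside : (s t : Bool) {p q : Fin n} (k : Fin n) → k ≢ p → k ≢ q →
                          lookup (longRoot s p t q) k ≡ 0ℤ
lookup-longRoot-outside s t {p} {q} k k≢p k≢q =
  trans (lookup-⊕ (signed s (e p)) (signed t (e q)) k)
        (cong₂ _+_ (lookup-signed-e-other s p k k≢p) (lookup-signed-e-other t q k k≢q))

longRoot-swap : (s : Bool) (p : Fin n) (t : Bool) (q : Fin n) → longRoot s p t q ≡ longRoot t q s p
longRoot-swap s p t q = ≗⇒≡ λ k → let u = signed s (e p); v = signed t (e q) in
  trans (lookup-⊕ u v k) (trans (ℤₚ.+-comm (lookup u k) (lookup v k)) (sym (lookup-⊕ v u k)))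

-- Positive roots are lexicographically positive: their first nonzero
-- coordinate is 1.  This is what makes the sign of ±e_p ± e_q visible.
Leading : V n → ℤ → Set
Leading {n} v x = Σ (Fin n) λ p → lookup v p ≡ x × (∀ k → k < p → lookup v k ≡ 0ℤ)

leading-unique : {v : V n} {x y : ℤ} → x ≢ 0ℤ → y ≢ 0ℤ → Leading v x → Leading v y → x ≡ y
leading-unique x≢0 y≢0 (p , vp≡x , below-p) (q , vq≡y , below-q) with Finₚ.<-cmp p q
... | tri< p<q _ _ = ⊥-elim (x≢0 (trans (sym vp≡x) (below-q p p<q)))
... | tri≈ _ refl _ = trans (sym vp≡x) vq≡y
... | tri> _ _ q<p = ⊥-elim (y≢0 (trans (sym vq≡y) (below-p q q<p)))

leading-signed-e : (b : Bool) (p : Fin n) → Leading (signed b (e p)) (sgn b 1ℤ)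
leading-signed-e b p =
  p , lookup-signed-e-same b p , λ k k<p → lookup-signed-e-other b p k (Finₚ.<⇒≢ k<p)

leading-longRoot : (s t : Bool) {p q : Fin n} → p < q → Leading (longRoot s p t q) (sgn s 1ℤ)
leading-longRoot s t {p} {q} p<q =
  p , lookup-longRoot-first s t (Finₚ.<⇒≢ p<q) ,
  λ k k<p → lookup-longRoot-outside s t k (Finₚ.<⇒≢ k<p) (Finₚ.<⇒≢ (Finₚ.<-trans k<p p<q))

posRoot-leading : {v : V n} → IsPosRoot v → Leading v 1ℤ
posRoot-leading (inj₁ (p , q , p<q , refl))        = leading-longRoot true false p<q
posRoot-leading (inj₂ (inj₁ (p , q , p<q , refl))) = leading-longRoot true true p<q
posRoot-leading (inj₂ (inj₂ (p , refl)))           = leading-signed-e true p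

positive-sign : (b : Bool) {v : V n} → Leading v (sgn b 1ℤ) → IsPosRoot v → b ≡ true
positive-sign b {v} lead pos =
  sgn-1≡1 b (leading-unique {v = v} (sgn-1≢0 b) (λ ()) lead (posRoot-leading pos))

posRoot-signed-e : (b : Bool) (p : Fin n) → IsPosRoot (signed b (e p)) ⇔ b ≡ true
posRoot-signed-e b p = mk⇔ (positive-sign b (leading-signed-e b p)) λ { refl → inj₂ (inj₂ (p , refl)) }

posRoot-longRoot : (s t : Bool) {p q : Fin n} → p < q → IsPosRoot (longRoot s p t q) ⇔ s ≡ true
posRoot-longRoot s t {p} {q} p<q = mk⇔ (positive-sign s (leading-longRoot s t p<q)) (positive t)
  where
  positive : (t : Bool) → s ≡ true → IsPosRoot (longRoot s p t q)
  positive false refl = inj₁ (p , q , p<q , refl)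
  positive true  refl = inj₂ (inj₁ (p , q , p<q , refl))

sign : Bool → ℤ
sign b = if b then -1ℤ else 1ℤ

lookup-act : (σ : Permutation′ n) (ε : Fin n → Bool) (v : V n) (k : Fin n) →
             lookup (act (sperm σ ε) v) k ≡ sign (ε (σ ⟨$⟩ˡ k)) * lookup v (σ ⟨$⟩ˡ k)
lookup-act σ ε v k = Vecₚ.lookup∘tabulate _ k

act-⊕ : (w : W n) (u v : V n) → act w (u ⊕ v) ≡ act w u ⊕ act w v
act-⊕ (sperm σ ε) u v = ≗⇒≡ λ k → let k′ = σ ⟨$⟩ˡ k; s = sign (ε k′) in begin
  lookup (w (u ⊕ v)) k                ≡⟨ lookup-act σ ε (u ⊕ v) k ⟩
  s * lookup (u ⊕ v) k′               ≡⟨ cong (s *_) (lookup-⊕ u v k′) ⟩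
  s * (lookup u k′ + lookup v k′)     ≡⟨ ℤₚ.*-distribˡ-+ s (lookup u k′) (lookup v k′) ⟩
  s * lookup u k′ + s * lookup v k′   ≡⟨ cong₂ _+_ (lookup-act σ ε u k) (lookup-act σ ε v k) ⟨
  lookup (w u) k + lookup (w v) k     ≡⟨ lookup-⊕ (w u) (w v) k ⟨
  lookup (w u ⊕ w v) k                ∎
  where
  open ≡-Reasoning
  w : V _ → V _
  w = act (sperm σ ε)

act-neg : (w : W n) (u : V n) → act w (neg u) ≡ neg (act w u)
act-neg (sperm σ ε) u = ≗⇒≡ λ k → let k′ = σ ⟨$⟩ˡ k; s = sign (ε k′) in begin
  lookup (act (sperm σ ε) (neg u)) k ≡⟨ lookup-act σ ε (neg u) k ⟩
  s * lookup (neg u) k′              ≡⟨ cong (s *_) (lookup-neg u k′) ⟩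
  s * - lookup u k′                  ≡⟨ ℤₚ.neg-distribʳ-* s (lookup u k′) ⟨
  - (s * lookup u k′)                ≡⟨ cong -_ (lookup-act σ ε u k) ⟨
  - lookup (act (sperm σ ε) u) k     ≡⟨ lookup-neg (act (sperm σ ε) u) k ⟨
  lookup (neg (act (sperm σ ε) u)) k ∎
  where open ≡-Reasoning

neg-⊕ : (u v : V n) → neg (u ⊕ v) ≡ neg u ⊕ neg v
neg-⊕ u v = ≗⇒≡ λ k → begin
  lookup (neg (u ⊕ v)) k          ≡⟨ lookup-neg (u ⊕ v) k ⟩
  - lookup (u ⊕ v) k              ≡⟨ cong -_ (lookup-⊕ u v k) ⟩
  - (lookup u k + lookup v k)     ≡⟨ ℤₚ.neg-distrib-+ (lookup u k) (lookup v k) ⟩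
  - lookup u k + - lookup v k     ≡⟨ cong₂ _+_ (lookup-neg u k) (lookup-neg v k) ⟨
  lookup (neg u) k + lookup (neg v) k ≡⟨ lookup-⊕ (neg u) (neg v) k ⟨
  lookup (neg u ⊕ neg v) k        ∎
  where open ≡-Reasoning

neg-signed : (b : Bool) (v : V n) → neg (signed b v) ≡ signed (not b) v
neg-signed true  v = refl
neg-signed false v = ≗⇒≡ λ k →
  trans (lookup-neg (neg v) k) (trans (cong -_ (lookup-neg v k)) (ℤₚ.neg-involutive (lookup v k)))

neg-act-e : (σ : Permutation′ n) (ε : Fin n → Bool) (i : Fin n) →
            neg (act (sperm σ ε) (e i)) ≡ signed (ε i) (e (σ ⟨$⟩ʳ i))
neg-act-e σ ε i = ≗⇒≡ λ k → trans (lookup-neg (act (sperm σ ε) (e i)) k)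
  (trans (cong -_ (lookup-act σ ε (e i) k))
  (trans (coordinate k) (sym (lookup-signed (ε i) (e (σ ⟨$⟩ʳ i)) k))))
  where
  coordinate : ∀ k → - (sign (ε (σ ⟨$⟩ˡ k)) * lookup (e i) (σ ⟨$⟩ˡ k))
                     ≡ sgn (ε i) (lookup (e (σ ⟨$⟩ʳ i)) k)
  coordinate k with k ≟ σ ⟨$⟩ʳ i
  ... | yes refl rewrite inverseˡ σ {i} | lookup-e-same i | lookup-e-same (σ ⟨$⟩ʳ i) with ε i
  ...   | true  = refl
  ...   | false = refl
  coordinate k | no k≢σi
    rewrite lookup-e-other (σ ⟨$⟩ʳ i) k k≢σi
          | lookup-e-other i (σ ⟨$⟩ˡ k)
              (λ σ⁻¹k≡i → k≢σi (trans (sym (inverseʳ σ)) (cong (σ ⟨$⟩ʳ_) σ⁻¹k≡i)))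
          | ℤₚ.*-zeroʳ (sign (ε (σ ⟨$⟩ˡ k)))
    = sym (sgn-0 (ε i))

applySign : Bool → Bool → Bool
applySign s x = if s then x else not x

neg-act-signed-e : (σ : Permutation′ n) (ε : Fin n → Bool) (s : Bool) (i : Fin n) →
                   neg (act (sperm σ ε) (signed s (e i))) ≡ signed (applySign s (ε i)) (e (σ ⟨$⟩ʳ i))
neg-act-signed-e σ ε true  i = neg-act-e σ ε i
neg-act-signed-e σ ε false i = begin
  neg (act w (neg (e i)))                  ≡⟨ cong neg (act-neg w (e i)) ⟩
  neg (neg (act w (e i)))                  ≡⟨ cong neg (neg-act-e σ ε i) ⟩
  neg (signed (ε i) (e (σ ⟨$⟩ʳ i)))        ≡⟨ neg-signed (ε i) (e (σ ⟨$⟩ʳ i)) ⟩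
  signed (not (ε i)) (e (σ ⟨$⟩ʳ i))        ∎
  where
  open ≡-Reasoning
  w = sperm σ ε

neg-act-longRoot : (σ : Permutation′ n) (ε : Fin n → Bool) (s t : Bool) (i j : Fin n) →
  neg (act (sperm σ ε) (longRoot s i t j))
    ≡ longRoot (applySign s (ε i)) (σ ⟨$⟩ʳ i) (applySign t (ε j)) (σ ⟨$⟩ʳ j)
neg-act-longRoot σ ε s t i j = begin
  neg (act w (u ⊕ v))               ≡⟨ cong neg (act-⊕ w u v) ⟩
  neg (act w u ⊕ act w v)           ≡⟨ neg-⊕ (act w u) (act w v) ⟩
  neg (act w u) ⊕ neg (act w v)     ≡⟨ cong₂ _⊕_ (neg-act-signed-e σ ε s i) (neg-act-signed-e σ ε t j) ⟩
  longRoot (applySign s (ε i)) (σ ⟨$⟩ʳ i) (applySign t (ε j)) (σ ⟨$⟩ʳ j) ∎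
  where
  open ≡-Reasoning
  w = sperm σ ε
  u = signed s (e i)
  v = signed t (e j)

black-e : (σ : Permutation′ n) (ε : Fin n → Bool) (i : Fin n) →
          Black (sperm σ ε) (e i) ⇔ ε i ≡ true
black-e σ ε i =
  subst (λ v → IsPosRoot v ⇔ ε i ≡ true) (sym (neg-act-e σ ε i)) (posRoot-signed-e (ε i) _)

black-longRoot : (σ : Permutation′ n) (ε : Fin n → Bool) (s t : Bool) {i j : Fin n} →
  σ ⟨$⟩ʳ i < σ ⟨$⟩ʳ j → Black (sperm σ ε) (longRoot s i t j) ⇔ applySign s (ε i) ≡ true
black-longRoot σ ε s t {i} {j} σi<σj =
  subst (λ v → IsPosRoot v ⇔ applySign s (ε i) ≡ true) (sym (neg-act-longRoot σ ε s t i j))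
        (posRoot-longRoot (applySign s (ε i)) (applySign t (ε j)) σi<σj)

black-longRoot-swapped : (σ : Permutation′ n) (ε : Fin n → Bool) (s t : Bool) {i j : Fin n} →
  σ ⟨$⟩ʳ j < σ ⟨$⟩ʳ i → Black (sperm σ ε) (longRoot s i t j) ⇔ applySign t (ε j) ≡ true
black-longRoot-swapped σ ε s t {i} {j} σj<σi =
  subst (λ v → IsPosRoot v ⇔ applySign t (ε j) ≡ true)
        (sym (trans (neg-act-longRoot σ ε s t i j) (longRoot-swap _ _ _ _)))
        (posRoot-longRoot (applySign t (ε j)) (applySign s (ε i)) σj<σi)

-- The simple-root coordinates of a vector β are the partial sums of its
-- coordinates: β = Σ c_k α_k  iff  c_k = β_0 + ⋯ + β_k.  The proof peels
-- off the first coordinate, since Σ c_k α_k = (c_0, c_1 − c_0, …).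
sumV : ∀ {m} → (Fin m → V n) → V n
sumV {n} F = foldr _ _⊕_ (replicate n 0ℤ) (tabulate F)

sumℤ : ∀ {m} → (Fin m → ℤ) → ℤ
sumℤ h = foldr _ _+_ 0ℤ (tabulate h)

sumV-∷ : ∀ {m} (h : Fin m → ℤ) (T : Fin m → V n) → sumV (λ i → h i ∷ T i) ≡ sumℤ h ∷ sumV T
sumV-∷ {m = zero}  h T = refl
sumV-∷ {m = suc m} h T = cong ((h zero ∷ T zero) ⊕_) (sumV-∷ (h ∘ suc) (T ∘ suc))

sumℤ-*0 : ∀ {m} (x : Fin m → ℤ) → sumℤ (λ i → x i * 0ℤ) ≡ 0ℤ
sumℤ-*0 {zero}  x = refl
sumℤ-*0 {suc m} x = cong₂ _+_ (ℤₚ.*-zeroʳ (x zero)) (sumℤ-*0 (x ∘ suc))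

subtractHead addToHead : ℤ → V n → V n
subtractHead c []      = []
subtractHead c (x ∷ v) = (x - c) ∷ v
addToHead c []      = []
addToHead c (x ∷ v) = (c + x) ∷ v

addToHead-0 : (v : V n) → addToHead 0ℤ v ≡ v
addToHead-0 []      = refl
addToHead-0 (x ∷ v) = cong (_∷ v) (ℤₚ.+-identityˡ x)

addToHead-subtractHead : (c : ℤ) (v : V n) → addToHead c (subtractHead c v) ≡ v
addToHead-subtractHead c []      = refl
addToHead-subtractHead c (x ∷ v) = cong (_∷ v) (cancel c x)
  where
  cancel : ∀ c x → c + (x - c) ≡ x
  cancel = solve-∀

subtractHead-addToHead : (c : ℤ) (v : V n) → subtractHead c (addToHead c v) ≡ v
subtractHead-addToHead c []      = refl
subtractHead-addToHead c (x ∷ v) = cong (_∷ v) (cancel c x)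
  where
  cancel : ∀ c x → (c + x) - c ≡ x
  cancel = solve-∀

zeros⊕ : (v : V n) → replicate n 0ℤ ⊕ v ≡ v
zeros⊕ []      = refl
zeros⊕ (x ∷ v) = cong₂ _∷_ (ℤₚ.+-identityˡ x) (zeros⊕ v)

tabulate-const : (x : ℤ) → tabulate {n} (λ _ → x) ≡ replicate n x
tabulate-const {zero}  x = refl
tabulate-const {suc n} x = cong (x ∷_) (tabulate-const x)

lin-∷ : (c₀ : ℤ) (cs : Vec ℤ n) → lin (c₀ ∷ cs) ≡ c₀ ∷ subtractHead c₀ (lin cs)
lin-∷ {n} c₀ cs =
  trans (sumV-∷ (λ i → lookup (c₀ ∷ cs) i * lookup (α {suc n} i) zero)
                (λ i → lookup (c₀ ∷ cs) i ⊙ tail (α {suc n} i)))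
        (cong₂ _∷_ head-coefficient (α₀-tail (lin cs)))
  where
  head-coefficient : c₀ * 1ℤ + sumℤ (λ i → lookup cs i * 0ℤ) ≡ c₀
  head-coefficient rewrite sumℤ-*0 (lookup cs) | ℤₚ.*-identityʳ c₀ = ℤₚ.+-identityʳ c₀
  -- below the first coordinate, α₀ = e₀ − e₁ contributes only −c₀ in coordinate 1
  α₀-tail : ∀ {m} (v : V m) → c₀ ⊙ tail (α {suc m} zero) ⊕ v ≡ subtractHead c₀ v
  α₀-tail []      = refl
  α₀-tail (x ∷ v) = cong₂ _∷_ (times-1 c₀ x) (begin
    c₀ ⊙ tabulate (λ _ → 0ℤ) ⊕ v ≡⟨ cong (λ z → c₀ ⊙ z ⊕ v) (tabulate-const 0ℤ) ⟩
    c₀ ⊙ replicate _ 0ℤ ⊕ v      ≡⟨ cong (_⊕ v) (Vecₚ.map-replicate (c₀ *_) 0ℤ _) ⟩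
    replicate _ (c₀ * 0ℤ) ⊕ v    ≡⟨ cong (λ z → replicate _ z ⊕ v) (ℤₚ.*-zeroʳ c₀) ⟩
    replicate _ 0ℤ ⊕ v           ≡⟨ zeros⊕ v ⟩
    v                             ∎)
    where
    open ≡-Reasoning
    times-1 : ∀ c x → c * -1ℤ + x ≡ x - c
    times-1 = solve-∀

runningSum : ℤ → V n → V n
runningSum a []      = []
runningSum a (x ∷ v) = (a + x) ∷ runningSum (a + x) v

lin-runningSum : (a : ℤ) (v : V n) → lin (runningSum a v) ≡ addToHead a v
lin-runningSum a []      = refl
lin-runningSum a (x ∷ v) = begin
  lin (b ∷ runningSum b v)
    ≡⟨ lin-∷ b (runningSum b v) ⟩
  b ∷ subtractHead b (lin (runningSum b v))
    ≡⟨ cong (λ u → b ∷ subtractHead b u) (lin-runningSum b v) ⟩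
  b ∷ subtractHead b (addToHead b v)
    ≡⟨ cong (b ∷_) (subtractHead-addToHead b v) ⟩
  b ∷ v ∎
  where
  open ≡-Reasoning
  b = a + x

runningSum-unique : (a : ℤ) (c v : V n) → lin c ≡ addToHead a v → c ≡ runningSum a v
runningSum-unique a []         []      _   = refl
runningSum-unique a (c₀ ∷ cs) (x ∷ v) lin≡ with Vecₚ.∷-injective (trans (sym (lin-∷ c₀ cs)) lin≡)
... | refl , tail≡ = cong ((a + x) ∷_) (runningSum-unique (a + x) cs v (begin
  lin cs                                                 ≡⟨ addToHead-subtractHead (a + x) (lin cs) ⟨
  addToHead (a + x) (subtractHead (a + x) (lin cs))      ≡⟨ cong (addToHead (a + x)) tail≡ ⟩
  addToHead (a + x) v                                    ∎))
  where open ≡-Reasoning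

hat-via-runningSum : (c β γ : V n) → lin c ≡ β →
  supp (runningSum 0ℤ β) ≡ runningSum 0ℤ γ → hat c ≡ γ
hat-via-runningSum c β γ lin≡ supp≡ = begin
  lin (supp c)
    ≡⟨ cong (lin ∘ supp) (runningSum-unique 0ℤ c β (trans lin≡ (sym (addToHead-0 β)))) ⟩
  lin (supp (runningSum 0ℤ β))  ≡⟨ cong lin supp≡ ⟩
  lin (runningSum 0ℤ γ)         ≡⟨ lin-runningSum 0ℤ γ ⟩
  addToHead 0ℤ γ                ≡⟨ addToHead-0 γ ⟩
  γ                             ∎
  where open ≡-Reasoning

-- Support computations for the three kinds of positive roots (i < j):
--   e_i − e_j = α_i + ⋯ + α_{j−1},   e_i = α_i + ⋯ + α_n,
--   e_i + e_j = α_i + ⋯ + α_{j−1} + 2(α_j + ⋯ + α_n).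
runningSum-zeros : (a : ℤ) → runningSum a (replicate n 0ℤ) ≡ replicate n a
runningSum-zeros {zero}  a = refl
runningSum-zeros {suc n} a rewrite ℤₚ.+-identityʳ a = cong (a ∷_) (runningSum-zeros a)

supp-replicate : (x : ℤ) →
  supp (replicate n x) ≡ replicate n (if does (x Data.Integer.≟ 0ℤ) then 0ℤ else 1ℤ)
supp-replicate {n} x = Vecₚ.map-replicate _ x n

supp-runningSum-diff : {i j : Fin n} → i < j →
  supp (runningSum 0ℤ (e i ⊕ neg (e j))) ≡ runningSum 0ℤ (e i ⊕ neg (e j))
supp-runningSum-diff {suc n} {zero} {suc j} _ rewrite tabulate-const {n} 0ℤ | zeros⊕ (neg (e j)) =
  cong (1ℤ ∷_) (after-i j)
  where
  after-i : ∀ {m} (j : Fin m) → supp (runningSum 1ℤ (neg (e j))) ≡ runningSum 1ℤ (neg (e j))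
  after-i {suc m} zero rewrite tabulate-const {m} 0ℤ | Vecₚ.map-replicate -_ 0ℤ m | runningSum-zeros {m} 0ℤ =
    cong (0ℤ ∷_) (supp-replicate 0ℤ)
  after-i {suc m} (suc j) = cong (1ℤ ∷_) (after-i j)
supp-runningSum-diff {suc n} {suc i} {suc j} (s≤s i<j) = cong (0ℤ ∷_) (supp-runningSum-diff i<j)

supp-runningSum-e : (i : Fin n) → supp (runningSum 0ℤ (e i)) ≡ runningSum 0ℤ (e i)
supp-runningSum-e {suc n} zero rewrite tabulate-const {n} 0ℤ | runningSum-zeros {n} 1ℤ =
  cong (1ℤ ∷_) (supp-replicate 1ℤ)
supp-runningSum-e {suc n} (suc i) = cong (0ℤ ∷_) (supp-runningSum-e i)

supp-runningSum-sum : {i j : Fin n} → i < j →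
  supp (runningSum 0ℤ (e i ⊕ e j)) ≡ runningSum 0ℤ (e i)
supp-runningSum-sum {suc n} {zero} {suc j} _
  rewrite tabulate-const {n} 0ℤ | zeros⊕ (e j) | runningSum-zeros {n} 1ℤ = cong (1ℤ ∷_) (after-i j)
  where
  after-i : ∀ {m} (j : Fin m) → supp (runningSum 1ℤ (e j)) ≡ replicate m 1ℤ
  after-i {suc m} zero rewrite tabulate-const {m} 0ℤ | runningSum-zeros {m} (Data.Integer.+ 2) =
    cong (1ℤ ∷_) (supp-replicate (Data.Integer.+ 2))
  after-i {suc m} (suc j) = cong (1ℤ ∷_) (after-i j)
supp-runningSum-sum {suc n} {suc i} {suc j} (s≤s i<j) = cong (0ℤ ∷_) (supp-runningSum-sum i<j)

inner-⊕ˡ : (u v x : V n) → ⟪ u ⊕ v , x ⟫ ≡ ⟪ u , x ⟫ + ⟪ v , x ⟫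
inner-⊕ˡ []      []      []      = refl
inner-⊕ˡ (a ∷ u) (b ∷ v) (c ∷ x) = trans (cong ((a + b) * c +_) (inner-⊕ˡ u v x)) (step a b c _ _)
  where
  step : ∀ a b c r s → (a + b) * c + (r + s) ≡ (a * c + r) + (b * c + s)
  step = solve-∀

inner-negˡ : (u x : V n) → ⟪ neg u , x ⟫ ≡ - ⟪ u , x ⟫
inner-negˡ []      []      = refl
inner-negˡ (a ∷ u) (c ∷ x) = trans (cong ((- a) * c +_) (inner-negˡ u x)) (step a c _)
  where
  step : ∀ a c r → (- a) * c + (- r) ≡ - (a * c + r)
  step = solve-∀

inner-zeros : (v : V n) → ⟪ replicate n 0ℤ , v ⟫ ≡ 0ℤ
inner-zeros []      = refl
inner-zeros (x ∷ v) = trans (ℤₚ.+-identityˡ ⟪ replicate _ 0ℤ , v ⟫) (inner-zeros v)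

inner-e : (a : Fin n) (v : V n) → ⟪ e a , v ⟫ ≡ lookup v a
inner-e {suc n} zero (x ∷ v) rewrite tabulate-const {n} 0ℤ | inner-zeros v =
  trans (ℤₚ.+-identityʳ (1ℤ * x)) (ℤₚ.*-identityˡ x)
inner-e {suc n} (suc a) (x ∷ v) = trans (ℤₚ.+-identityˡ ⟪ e a , v ⟫) (inner-e a v)

both : {A B : Set} → A → B → A ⇔ B
both a b = mk⇔ (λ _ → b) (λ _ → a)

neither : {A B : Set} → ¬ A → ¬ B → A ⇔ B
neither ¬a ¬b = mk⇔ (⊥-elim ∘ ¬a) (⊥-elim ∘ ¬b)

-- For i < j, the roots b₁ = e_i − e_j (long) and b₂ = e_j (short) span a
-- subsystem of type B₂ whose positive roots are b₁, b₂, b₁ + b₂ = e_i and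
-- b₁ + 2b₂ = e_i + e_j.
module B₂Subsystem {n} {i j : Fin n} (i<j : i < j) where

  i≢j : i ≢ j
  i≢j = Finₚ.<⇒≢ i<j

  b₁ b₂ : V n
  b₁ = e i ⊕ neg (e j)
  b₂ = e j

  b₁+b₂ : b₁ ⊕ b₂ ≡ e i
  b₁+b₂ = ≗⇒≡ λ k → begin
    lookup (b₁ ⊕ b₂) k
      ≡⟨ lookup-⊕ b₁ b₂ k ⟩
    lookup b₁ k + lookup (e j) k
      ≡⟨ cong (_+ lookup (e j) k) (lookup-⊕ (e i) (neg (e j)) k) ⟩
    lookup (e i) k + lookup (neg (e j)) k + lookup (e j) k
      ≡⟨ cong (λ y → lookup (e i) k + y + lookup (e j) k) (lookup-neg (e j) k) ⟩
    lookup (e i) k + - lookup (e j) k + lookup (e j) k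
      ≡⟨ cancel (lookup (e i) k) (lookup (e j) k) ⟩
    lookup (e i) k ∎
    where
    open ≡-Reasoning
    cancel : ∀ x y → x + - y + y ≡ x
    cancel = solve-∀

  b₁+2b₂ : b₁ ⊕ b₂ ⊕ b₂ ≡ e i ⊕ e j
  b₁+2b₂ = cong (_⊕ b₂) b₁+b₂

  -- the four roots are told apart by their coordinates i and j
  coords : V n → ℤ × ℤ
  coords v = lookup v i , lookup v j

  coords-b₁ : coords b₁ ≡ (1ℤ , -1ℤ)
  coords-b₁ =
    cong₂ _,_ (lookup-longRoot-first true false i≢j) (lookup-longRoot-second true false i≢j)

  coords-b₂ : coords b₂ ≡ (0ℤ , 1ℤ)
  coords-b₂ = cong₂ _,_ (lookup-e-other j i i≢j) (lookup-e-same j)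

  coords-b₁+b₂ : coords (b₁ ⊕ b₂) ≡ (1ℤ , 0ℤ)
  coords-b₁+b₂ = trans (cong coords b₁+b₂)
    (cong₂ _,_ (lookup-e-same i) (lookup-e-other i j (i≢j ∘ sym)))

  coords-b₁+2b₂ : coords (b₁ ⊕ b₂ ⊕ b₂) ≡ (1ℤ , 1ℤ)
  coords-b₁+2b₂ = trans (cong coords b₁+2b₂)
    (cong₂ _,_ (lookup-longRoot-first true true i≢j) (lookup-longRoot-second true true i≢j))

  apart : {u v : V n} {x y : ℤ × ℤ} → coords u ≡ x → coords v ≡ y → x ≢ y → u ≢ v
  apart u↦x v↦y x≢y u≡v = x≢y (trans (sym u↦x) (trans (cong coords u≡v) v↦y))

  i-minus-j : ℤ × ℤ → ℤ
  i-minus-j (x , y) = x + - y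

  inner-b₁ : (x : V n) → ⟪ b₁ , x ⟫ ≡ i-minus-j (coords x)
  inner-b₁ x = trans (inner-⊕ˡ (e i) (neg (e j)) x)
                     (cong₂ _+_ (inner-e i x) (trans (inner-negˡ (e j) x) (cong -_ (inner-e j x))))

  inner-b₂b₂ : ⟪ b₂ , b₂ ⟫ ≡ 1ℤ
  inner-b₂b₂ = trans (inner-e j b₂) (lookup-e-same j)

  inner-b₁b₁ : ⟪ b₁ , b₁ ⟫ ≡ Data.Integer.+ 2 * ⟪ b₂ , b₂ ⟫
  inner-b₁b₁ = trans (trans (inner-b₁ b₁) (cong i-minus-j coords-b₁))
                     (sym (cong (Data.Integer.+ 2 *_) inner-b₂b₂))

  inner-b₁b₂ : ⟪ b₁ , b₂ ⟫ ≡ - ⟪ b₂ , b₂ ⟫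
  inner-b₁b₂ = trans (trans (inner-b₁ b₂) (cong i-minus-j coords-b₂)) (sym (cong -_ inner-b₂b₂))

  Candidate : V n → Set
  Candidate γ = γ ≡ b₁ ⊎ γ ≡ b₂ ⊎ γ ≡ b₁ ⊕ b₂ ⊎ γ ≡ b₁ ⊕ b₂ ⊕ b₂

  SupportedOn-ij : V n → Set
  SupportedOn-ij γ = ∀ k → k ≢ i → k ≢ j → lookup γ k ≡ 0ℤ

  span-support : {γ : V n} → InSpan2 γ b₁ b₂ → SupportedOn-ij γ
  span-support {γ} (c , c₁ , c₂ , c≢0 , c·γ≡) k k≢i k≢j =
    [ ⊥-elim ∘ c≢0 , id ] (ℤₚ.i*j≡0⇒i≡0∨j≡0 c (begin
      c * lookup γ k                      ≡⟨ lookup-⊙ c γ k ⟨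
      lookup (c ⊙ γ) k                    ≡⟨ cong (λ v → lookup v k) c·γ≡ ⟩
      lookup (c₁ ⊙ b₁ ⊕ c₂ ⊙ b₂) k        ≡⟨ lookup-⊕ (c₁ ⊙ b₁) (c₂ ⊙ b₂) k ⟩
      lookup (c₁ ⊙ b₁) k + lookup (c₂ ⊙ b₂) k
                                          ≡⟨ cong₂ _+_ (lookup-⊙ c₁ b₁ k) (lookup-⊙ c₂ b₂ k) ⟩
      c₁ * lookup b₁ k + c₂ * lookup b₂ k ≡⟨ cong₂ (λ x y → c₁ * x + c₂ * y)
                                               (lookup-longRoot-outside true false k k≢i k≢j)
                                               (lookup-e-other j k k≢j) ⟩
      c₁ * 0ℤ + c₂ * 0ℤ                   ≡⟨ cong₂ _+_ (ℤₚ.*-zeroʳ c₁) (ℤₚ.*-zeroʳ c₂) ⟩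
      0ℤ                                  ∎))
    where open ≡-Reasoning

  inside : {γ : V n} → SupportedOn-ij γ → ∀ k → lookup γ k ≢ 0ℤ → k ≡ i ⊎ k ≡ j
  inside supported k γk≢0 with k ≟ i | k ≟ j
  ... | yes k≡i | _       = inj₁ k≡i
  ... | no _    | yes k≡j = inj₂ k≡j
  ... | no k≢i  | no k≢j  = ⊥-elim (γk≢0 (supported k k≢i k≢j))

  ordered : {p q : Fin n} → p ≡ i ⊎ p ≡ j → q ≡ i ⊎ q ≡ j → p < q → p ≡ i × q ≡ j
  ordered (inj₁ p≡i)  (inj₂ q≡j)  _   = p≡i , q≡j
  ordered (inj₁ refl) (inj₁ refl) p<q = ⊥-elim (Finₚ.<-irrefl refl p<q)
  ordered (inj₂ refl) (inj₂ refl) p<q = ⊥-elim (Finₚ.<-irrefl refl p<q)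
  ordered (inj₂ refl) (inj₁ refl) p<q = ⊥-elim (Finₚ.<-asym p<q i<j)

  longRoot-indices : (t : Bool) {p q : Fin n} → p < q →
                     SupportedOn-ij (longRoot true p t q) → p ≡ i × q ≡ j
  longRoot-indices t {p} {q} p<q supported = ordered
    (inside {γ} supported p (sgn-1≢0 true ∘ trans (sym (lookup-longRoot-first true t p≢q))))
    (inside {γ} supported q (sgn-1≢0 t ∘ trans (sym (lookup-longRoot-second true t p≢q))))
    p<q
    where
    γ = longRoot true p t q
    p≢q = Finₚ.<⇒≢ p<q

  supported-posRoot : {γ : V n} → IsPosRoot γ → SupportedOn-ij γ → Candidate γ
  supported-posRoot (inj₁ (p , q , p<q , refl)) supported with longRoot-indices false p<q supported
  ... | refl , refl = inj₁ refl
  supported-posRoot (inj₂ (inj₁ (p , q , p<q , refl))) supported with longRoot-indices true p<q supported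
  ... | refl , refl = inj₂ (inj₂ (inj₂ (sym b₁+2b₂)))
  supported-posRoot (inj₂ (inj₂ (p , refl))) supported
    with inside {e p} supported p (λ ep≡0 → sgn-1≢0 true (trans (sym (lookup-e-same p)) ep≡0))
  ... | inj₁ refl = inj₂ (inj₂ (inj₁ (sym b₁+b₂)))
  ... | inj₂ refl = inj₂ (inj₁ refl)

  combination-inSpan : (c₁ c₂ : ℤ) {γ : V n} →
    (∀ k → lookup γ k ≡ c₁ * lookup b₁ k + c₂ * lookup b₂ k) → InSpan2 γ b₁ b₂
  combination-inSpan c₁ c₂ {γ} coordinates = 1ℤ , c₁ , c₂ , (λ ()) , ≗⇒≡ λ k → begin
    lookup (1ℤ ⊙ γ) k                        ≡⟨ lookup-⊙ 1ℤ γ k ⟩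
    1ℤ * lookup γ k                          ≡⟨ ℤₚ.*-identityˡ (lookup γ k) ⟩
    lookup γ k                               ≡⟨ coordinates k ⟩
    c₁ * lookup b₁ k + c₂ * lookup b₂ k      ≡⟨ cong₂ _+_ (lookup-⊙ c₁ b₁ k) (lookup-⊙ c₂ b₂ k) ⟨
    lookup (c₁ ⊙ b₁) k + lookup (c₂ ⊙ b₂) k  ≡⟨ lookup-⊕ (c₁ ⊙ b₁) (c₂ ⊙ b₂) k ⟨
    lookup (c₁ ⊙ b₁ ⊕ c₂ ⊙ b₂) k             ∎
    where open ≡-Reasoning

  candidate-inSpan : {γ : V n} → Candidate γ → InSpan2 γ b₁ b₂
  candidate-inSpan (inj₁ refl) =
    combination-inSpan 1ℤ 0ℤ λ k → is-b₁ (lookup b₁ k) (lookup b₂ k)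
    where
    is-b₁ : ∀ x y → x ≡ 1ℤ * x + 0ℤ * y
    is-b₁ = solve-∀
  candidate-inSpan (inj₂ (inj₁ refl)) =
    combination-inSpan 0ℤ 1ℤ λ k → is-b₂ (lookup b₁ k) (lookup b₂ k)
    where
    is-b₂ : ∀ x y → y ≡ 0ℤ * x + 1ℤ * y
    is-b₂ = solve-∀
  candidate-inSpan (inj₂ (inj₂ (inj₁ refl))) =
    combination-inSpan 1ℤ 1ℤ λ k →
      trans (lookup-⊕ b₁ b₂ k) (is-b₁+b₂ (lookup b₁ k) (lookup b₂ k))
    where
    is-b₁+b₂ : ∀ x y → x + y ≡ 1ℤ * x + 1ℤ * y
    is-b₁+b₂ = solve-∀
  candidate-inSpan (inj₂ (inj₂ (inj₂ refl))) =
    combination-inSpan 1ℤ (Data.Integer.+ 2) λ k →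
      trans (lookup-⊕ (b₁ ⊕ b₂) b₂ k)
            (trans (cong (_+ lookup b₂ k) (lookup-⊕ b₁ b₂ k)) (is-b₁+2b₂ (lookup b₁ k) (lookup b₂ k)))
    where
    is-b₁+2b₂ : ∀ x y → x + y + y ≡ 1ℤ * x + Data.Integer.+ 2 * y
    is-b₁+2b₂ = solve-∀

  isB₂ : IsB2 b₁ b₂
  isB₂ = inj₁ (i , j , i<j , refl) , inj₂ (inj₂ (j , refl)) , inner-b₁b₁ , inner-b₁b₂ ,
         λ γ pos → mk⇔ (supported-posRoot pos ∘ span-support) candidate-inSpan

  agree-on-candidates : (P Q : V n → Set) →
    P b₁ ⇔ Q b₁ → P b₂ ⇔ Q b₂ → P (b₁ ⊕ b₂) ⇔ Q (b₁ ⊕ b₂) →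
    P (b₁ ⊕ b₂ ⊕ b₂) ⇔ Q (b₁ ⊕ b₂ ⊕ b₂) →
    {γ : V n} → Candidate γ → P γ ⇔ Q γ
  agree-on-candidates P Q p₁ _  _  _  (inj₁ refl)                 = p₁
  agree-on-candidates P Q _  p₂ _  _  (inj₂ (inj₁ refl))          = p₂
  agree-on-candidates P Q _  _  p₃ _  (inj₂ (inj₂ (inj₁ refl)))   = p₃
  agree-on-candidates P Q _  _  _  p₄ (inj₂ (inj₂ (inj₂ refl)))   = p₄

  long-pattern : (Bl : V n → Set) → Bl b₁ → Bl (e i) → ¬ Bl b₂ → ¬ Bl (e i ⊕ e j) →
    ∀ γ → IsPosRoot γ → InSpan2 γ b₁ b₂ → Bl γ ⇔ (γ ≡ b₁ ⊎ γ ≡ b₁ ⊕ b₂)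
  long-pattern Bl bl-b₁ bl-b₁+b₂ ¬bl-b₂ ¬bl-b₁+2b₂ γ pos span =
    agree-on-candidates Bl (λ γ → γ ≡ b₁ ⊎ γ ≡ b₁ ⊕ b₂)
      (both bl-b₁ (inj₁ refl))
      (neither ¬bl-b₂ [ apart coords-b₂ coords-b₁ (λ ()) , apart coords-b₂ coords-b₁+b₂ (λ ()) ])
      (both (subst Bl (sym b₁+b₂) bl-b₁+b₂) (inj₂ refl))
      (neither (¬bl-b₁+2b₂ ∘ subst Bl b₁+2b₂)
               [ apart coords-b₁+2b₂ coords-b₁ (λ ()) , apart coords-b₁+2b₂ coords-b₁+b₂ (λ ()) ])
      (supported-posRoot pos (span-support span))

  short-pattern : (Bl : V n → Set) → Bl b₂ → Bl (e i ⊕ e j) → ¬ Bl b₁ → ¬ Bl (e i) →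
    ∀ γ → IsPosRoot γ → InSpan2 γ b₁ b₂ → Bl γ ⇔ (γ ≡ b₂ ⊎ γ ≡ b₁ ⊕ b₂ ⊕ b₂)
  short-pattern Bl bl-b₂ bl-b₁+2b₂ ¬bl-b₁ ¬bl-b₁+b₂ γ pos span =
    agree-on-candidates Bl (λ γ → γ ≡ b₂ ⊎ γ ≡ b₁ ⊕ b₂ ⊕ b₂)
      (neither ¬bl-b₁ [ apart coords-b₁ coords-b₂ (λ ()) , apart coords-b₁ coords-b₁+2b₂ (λ ()) ])
      (both bl-b₂ (inj₁ refl))
      (neither (¬bl-b₁+b₂ ∘ subst Bl b₁+b₂)
               [ apart coords-b₁+b₂ coords-b₂ (λ ()) , apart coords-b₁+b₂ coords-b₁+2b₂ (λ ()) ])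
      (both (subst Bl (sym b₁+2b₂) bl-b₁+2b₂) (inj₂ refl))
      (supported-posRoot pos (span-support span))

holds : {A : Set} {x : Bool} → A ⇔ x ≡ true → x ≡ true → A
holds = Equivalence.from

fails : {A : Set} {x : Bool} → A ⇔ x ≡ true → x ≡ false → ¬ A
fails A⇔x x≡false a with trans (sym (Equivalence.to A⇔x a)) x≡false
... | ()

permutation-injective : (σ : Permutation′ n) {i j : Fin n} → σ ⟨$⟩ʳ i ≡ σ ⟨$⟩ʳ j → i ≡ j
permutation-injective σ σi≡σj =
  trans (sym (inverseˡ σ)) (trans (cong (σ ⟨$⟩ˡ_) σi≡σj) (inverseˡ σ))

-- If σ i < σ j both colours are
-- read off ε i.  Otherwise e_i + e_j has the colour of e_j, and two
-- different colours on e_i, e_j would make the subsystem spanned by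
-- e_i − e_j, e_j a B₂ pattern of length two.
sum-colour : (w : W n) → ¬ ContainsB2len2 w → {i j : Fin n} → i < j →
             Black w (e i ⊕ e j) ⇔ Black w (e i)
sum-colour (sperm σ ε) avoid {i} {j} i<j with Finₚ.<-cmp (σ ⟨$⟩ʳ i) (σ ⟨$⟩ʳ j)
... | tri< σi<σj _ _ = ⇔.trans (black-longRoot σ ε true true σi<σj) (⇔.sym (black-e σ ε i))
... | tri≈ _ σi≡σj _ = ⊥-elim (Finₚ.<⇒≢ i<j (permutation-injective σ σi≡σj))
... | tri> _ _ σj<σi = compare (ε i) (ε j) refl refl
  where
  open B₂Subsystem i<j
  w : W _
  w = sperm σ ε

  black-sum : Black w (e i ⊕ e j) ⇔ ε j ≡ true
  black-sum = black-longRoot-swapped σ ε true true σj<σi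

  black-b₁ : Black w b₁ ⇔ not (ε j) ≡ true
  black-b₁ = black-longRoot-swapped σ ε true false σj<σi

  compare : ∀ x y → ε i ≡ x → ε j ≡ y → Black w (e i ⊕ e j) ⇔ Black w (e i)
  compare true  true  εi εj = both (holds black-sum εj) (holds (black-e σ ε i) εi)
  compare false false εi εj = neither (fails black-sum εj) (fails (black-e σ ε i) εi)
  compare true  false εi εj = ⊥-elim (avoid (b₁ , b₂ , isB₂ , inj₁ (long-pattern (Black w)
    (holds black-b₁ (cong not εj)) (holds (black-e σ ε i) εi)
    (fails (black-e σ ε j) εj) (fails black-sum εj))))
  compare false true  εi εj = ⊥-elim (avoid (b₁ , b₂ , isB₂ , inj₂ (short-pattern (Black w)
    (holds (black-e σ ε j) εj) (holds black-sum εj)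
    (fails black-b₁ (cong not εj)) (fails (black-e σ ε i) εi))))

black-≡ : (w : W n) {u v : V n} → u ≡ v → Black w u ⇔ Black w v
black-≡ w refl = ⇔.refl

lemma6p7 : (n : ℕ) (w : W n) →
    ¬ Contains3142 w → ¬ Contains2413 w → ¬ ContainsB2len2 w →
    (β : V n) → IsPosRoot β → (c : Vec ℤ n) → lin c ≡ β →
    (Black w β ⇔ Black w (hat c))
lemma6p7 n w _ _ avoidB₂ β (inj₁ (i , j , i<j , refl)) c lin-c≡β =
  black-≡ w (sym (hat-via-runningSum c β β lin-c≡β (supp-runningSum-diff i<j)))
lemma6p7 n w _ _ avoidB₂ β (inj₂ (inj₁ (i , j , i<j , refl))) c lin-c≡β =
  ⇔.trans (sum-colour w avoidB₂ i<j)
          (black-≡ w (sym (hat-via-runningSum c β (e i) lin-c≡β (supp-runningSum-sum i<j))))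
lemma6p7 n w _ _ avoidB₂ β (inj₂ (inj₂ (i , refl))) c lin-c≡β =
  black-≡ w (sym (hat-via-runningSum c β β lin-c≡β (supp-runningSum-e i)))
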